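{- Let $n\ge1$ and let $A$ be a real $n\times n$ matrix with $\operatorname{rank}(A)=1$. Then $\operatorname{dih}(A)=0$.
   Context: For $n\ge1$ and $k=1,\dots,n$, let $\rho_k$ be the permutation of $\{1,\dots,n\}$ with $\rho_k(1)=k,\rho_k(2)=k+1,\dots,\rho_k(n-k+1)=n,\rho_k(n-k+2)=1,\dots,\rho_k(n)=k-1$, and let $\mu_k$ be the permutation with $\mu_k(1)=k,\mu_k(2)=k-1,\dots,\mu_k(k)=1,\mu_k(k+1)=n,\mu_k(k+2)=n-1,\dots,\mu_k(n)=k+1$. For an $n\times n$ matrix $A=(a_{i,j})$, the dihedrant is $$\operatorname{dih}(A)=\sum_{k=1}^n\prod_{i=1}^n a_{i,\rho_k(i)}-\sum_{k=1}^n\prod_{i=1}^n a_{i,\mu_k(i)}.$$ -}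

module Defs where

open import Level using (Level)
import Data.Nat as N
open N using (ℕ; zero; suc)
open import Data.Nat.DivMod using (_mod_)
open import Data.Fin using (Fin; toℕ)
import Data.Fin as Fin
open import Data.Product using (Σ; ∃; _×_)
open import Relation.Nullary using (¬_)
open import Algebra.Bundles using (CommutativeRing)

module _ {c ℓ : Level} (R : CommutativeRing c ℓ) where
  open CommutativeRing R

  ∑ : ∀ {n} → (Fin n → Carrier) → Carrier
  ∑ {zero}  f = 0#
  ∑ {suc n} f = f Fin.zero + ∑ (λ i → f (Fin.suc i))

  ∏ : ∀ {n} → (Fin n → Carrier) → Carrier
  ∏ {zero}  f = 1#
  ∏ {suc n} f = f Fin.zero * ∏ (λ i → f (Fin.suc i))

  -- 0-indexed versions of ρ_k and μ_k on Fin (suc m):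
  -- ρ_k(i) = (i + k) mod n ,  μ_k(i) = (k - i) mod n
  ρ : ∀ {m} → Fin (suc m) → Fin (suc m) → Fin (suc m)
  ρ {m} k i = (toℕ i N.+ toℕ k) mod (suc m)

  μ : ∀ {m} → Fin (suc m) → Fin (suc m) → Fin (suc m)
  μ {m} k i = (toℕ k N.+ (suc m N.∸ toℕ i)) mod (suc m)

  dih : ∀ {m} → (Fin (suc m) → Fin (suc m) → Carrier) → Carrier
  dih A = ∑ (λ k → ∏ (λ i → A i (ρ k i))) - ∑ (λ k → ∏ (λ i → A i (μ k i)))

  NonZeroVec : ∀ {n} → (Fin n → Carrier) → Set ℓ
  NonZeroVec w = Σ _ λ j → ¬ (w j ≈ 0#)

  InRowSpace : ∀ {m n} → (Fin m → Fin n → Carrier) → (Fin n → Carrier) → Set (c Level.⊔ ℓ)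
  InRowSpace A x = Σ _ λ (λs : Fin _ → Carrier) → ∀ j → x j ≈ ∑ (λ i → λs i * A i j)

  -- rank(A) = 1 : the row space of A has a basis consisting of one vector w,
  -- i.e. w ≠ 0, every row of A is a multiple of w, and w is in the row space of A.
  RankOne : ∀ {m n} → (Fin m → Fin n → Carrier) → Set (c Level.⊔ ℓ)
  RankOne {m} {n} A =
    Σ (Fin n → Carrier) λ w →
      NonZeroVec w
      × (∀ i → Σ Carrier λ a → ∀ j → A i j ≈ a * w j)
      × InRowSpace A w

-- If every row of A is a multiple of one row vector w, say A i j ≈ a i * w j,
-- then for every permutation σ of the column indices the diagonal product
-- ∏ᵢ A i (σ i) factors as (∏ a) * ∏ᵢ w (σ i) ≈ (∏ a) * (∏ w): it does not
-- depend on σ.  Every ρ_k is a permutation (the rotation i ↦ i + k mod n) and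
-- every μ_k is a permutation (the reflection i ↦ -i mod n followed by the
-- rotation by k).  Hence both sums in dih A consist of n copies of the same
-- value and their difference is 0.
module Submission where

open import Defs
open import Level using (Level)
open import Data.Nat using (ℕ; zero; suc; _+_; _∸_; _%_; _<_; NonZero; z<s)
open import Algebra.Bundles using (CommutativeRing)
open import Data.Nat.Properties
  using (+-assoc; +-comm; <⇒≤; ∸-monoʳ-<; m∸[m∸n]≡n; m∸n+n≡m)
open import Data.Nat.DivMod
  using (_mod_; %-distribˡ-+; m%n%n≡m%n; m<n⇒m%n≡m; n%n≡0; [m+n]%n≡m%n)
open import Data.Fin using (Fin; toℕ)
import Data.Fin as Fin
open import Data.Fin.Properties using (toℕ-injective; toℕ-fromℕ<; toℕ<n)
open import Data.Fin.Permutation using (Permutation; permutation; _⟨$⟩ʳ_; _∘ₚ_)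
open import Data.Product using (Σ; _,_; proj₁; proj₂)
import Relation.Binary.PropositionalEquality as ≡
open ≡ using (_≡_)
import Algebra.Properties.CommutativeMonoid.Sum as MonoidSum

IsPermutation : ∀ {n} → (Fin n → Fin n) → Set
IsPermutation {n} σ = Σ (Permutation n n) λ π → ∀ i → σ i ≡ π ⟨$⟩ʳ i

module Modular (n : ℕ) .{{_ : NonZero n}} where
  open ≡ using (trans; cong)
  open ≡.≡-Reasoning

  toℕ-mod : ∀ x → toℕ (x mod n) ≡ x % n
  toℕ-mod x = toℕ-fromℕ< _

  %-absorbˡ : ∀ x y → (x % n + y) % n ≡ (x + y) % n
  %-absorbˡ x y = begin
    (x % n + y) % n          ≡⟨ %-distribˡ-+ (x % n) y n ⟩
    (x % n % n + y % n) % n  ≡⟨ cong (λ z → (z + y % n) % n) (m%n%n≡m%n x n) ⟩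
    (x % n + y % n) % n      ≡⟨ %-distribˡ-+ x y n ⟨
    (x + y) % n              ∎

  rotate : ℕ → Fin n → Fin n
  rotate t i = (toℕ i + t) mod n

  rotate-rotate : ∀ s t i → rotate t (rotate s i) ≡ rotate (s + t) i
  rotate-rotate s t i = toℕ-injective (begin
    toℕ (rotate t (rotate s i))  ≡⟨ toℕ-mod _ ⟩
    (toℕ (rotate s i) + t) % n   ≡⟨ cong (λ z → (z + t) % n) (toℕ-mod _) ⟩
    ((toℕ i + s) % n + t) % n    ≡⟨ %-absorbˡ (toℕ i + s) t ⟩
    (toℕ i + s + t) % n          ≡⟨ cong (_% n) (+-assoc (toℕ i) s t) ⟩
    (toℕ i + (s + t)) % n        ≡⟨ toℕ-mod _ ⟨
    toℕ (rotate (s + t) i)       ∎)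

  rotate-n : ∀ i → rotate n i ≡ i
  rotate-n i = toℕ-injective (begin
    toℕ (rotate n i)  ≡⟨ toℕ-mod _ ⟩
    (toℕ i + n) % n   ≡⟨ [m+n]%n≡m%n (toℕ i) n ⟩
    toℕ i % n         ≡⟨ m<n⇒m%n≡m (toℕ<n i) ⟩
    toℕ i             ∎)

  rotation : Fin n → Permutation n n
  rotation k = permutation (rotate (toℕ k)) (rotate (n ∸ toℕ k)) undo redo
    where
    full-turn : ∀ i → rotate ((n ∸ toℕ k) + toℕ k) i ≡ i
    full-turn i = trans (cong (λ t → rotate t i) (m∸n+n≡m (<⇒≤ (toℕ<n k)))) (rotate-n i)
    undo : ∀ i → rotate (toℕ k) (rotate (n ∸ toℕ k) i) ≡ i
    undo i = trans (rotate-rotate _ _ i) (full-turn i)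
    redo : ∀ i → rotate (n ∸ toℕ k) (rotate (toℕ k) i) ≡ i
    redo i = trans (rotate-rotate _ _ i)
                   (trans (cong (λ t → rotate t i) (+-comm (toℕ k) _)) (full-turn i))

  negate : Fin n → Fin n
  negate i = (n ∸ toℕ i) mod n

  negate-negate-ℕ : ∀ x → x < n → (n ∸ (n ∸ x) % n) % n ≡ x
  negate-negate-ℕ zero    _   = begin
    (n ∸ n % n) % n  ≡⟨ cong (λ z → (n ∸ z) % n) (n%n≡0 n) ⟩
    n % n            ≡⟨ n%n≡0 n ⟩
    0                ∎
  negate-negate-ℕ (suc y) y<n = begin
    (n ∸ (n ∸ suc y) % n) % n  ≡⟨ cong (λ z → (n ∸ z) % n) (m<n⇒m%n≡m n∸y<n) ⟩
    (n ∸ (n ∸ suc y)) % n      ≡⟨ cong (_% n) (m∸[m∸n]≡n (<⇒≤ y<n)) ⟩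
    suc y % n                  ≡⟨ m<n⇒m%n≡m y<n ⟩
    suc y                      ∎
    where
    n∸y<n : n ∸ suc y < n
    n∸y<n = ∸-monoʳ-< {m = n} z<s (<⇒≤ y<n)

  negate-involutive : ∀ i → negate (negate i) ≡ i
  negate-involutive i = toℕ-injective (begin
    toℕ (negate (negate i))    ≡⟨ toℕ-mod _ ⟩
    (n ∸ toℕ (negate i)) % n   ≡⟨ cong (λ z → (n ∸ z) % n) (toℕ-mod _) ⟩
    (n ∸ (n ∸ toℕ i) % n) % n  ≡⟨ negate-negate-ℕ (toℕ i) (toℕ<n i) ⟩
    toℕ i                      ∎)

  negation : Permutation n n
  negation = permutation negate negate negate-involutive negate-involutive

  reflect-as-rotation : ∀ k i →
    (k + (n ∸ toℕ i)) mod n ≡ rotate k (negate i)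
  reflect-as-rotation k i = toℕ-injective (begin
    toℕ ((k + (n ∸ toℕ i)) mod n)  ≡⟨ toℕ-mod _ ⟩
    (k + (n ∸ toℕ i)) % n          ≡⟨ cong (_% n) (+-comm k _) ⟩
    ((n ∸ toℕ i) + k) % n          ≡⟨ %-absorbˡ (n ∸ toℕ i) k ⟨
    ((n ∸ toℕ i) % n + k) % n      ≡⟨ cong (λ z → (z + k) % n) (toℕ-mod _) ⟨
    (toℕ (negate i) + k) % n       ≡⟨ toℕ-mod _ ⟨
    toℕ (rotate k (negate i))      ∎)

module Products {c ℓ : Level} (R : CommutativeRing c ℓ) where
  open CommutativeRing R
  open MonoidSum *-commutativeMonoid
    using () renaming (sum to product; sum-cong-≋ to product-cong;
                       ∑-distrib-+ to product-distrib; ∑-permute to product-permute)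
  open ≡ using (cong; cong₂)
  open import Relation.Binary.Reasoning.Setoid setoid

  ∏≡product : ∀ {n} (f : Fin n → Carrier) → ∏ R f ≡ product f
  ∏≡product {zero}  f = ≡.refl
  ∏≡product {suc n} f = cong (f Fin.zero *_) (∏≡product (λ i → f (Fin.suc i)))

  ∏-cong : ∀ {n} {f g : Fin n → Carrier} → (∀ i → f i ≈ g i) → ∏ R f ≈ ∏ R g
  ∏-cong {f = f} {g} f≈g = begin
    ∏ R f      ≡⟨ ∏≡product f ⟩
    product f  ≈⟨ product-cong f≈g ⟩
    product g  ≡⟨ ∏≡product g ⟨
    ∏ R g      ∎

  ∏-distrib-* : ∀ {n} (f g : Fin n → Carrier) →
                ∏ R (λ i → f i * g i) ≈ ∏ R f * ∏ R g
  ∏-distrib-* {n} f g = begin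
    ∏ R (λ i → f i * g i)      ≡⟨ ∏≡product {n} _ ⟩
    product (λ i → f i * g i)  ≈⟨ product-distrib f g ⟩
    product f * product g      ≡⟨ cong₂ _*_ (∏≡product f) (∏≡product g) ⟨
    ∏ R f * ∏ R g              ∎

  ∏-permute : ∀ {n} (f : Fin n → Carrier) {σ : Fin n → Fin n} →
              IsPermutation σ → ∏ R (λ i → f (σ i)) ≈ ∏ R f
  ∏-permute {n} f {σ} (π , σ≡π) = begin
    ∏ R (λ i → f (σ i))             ≈⟨ ∏-cong (λ i → reflexive (cong f (σ≡π i))) ⟩
    ∏ R (λ i → f (π ⟨$⟩ʳ i))        ≡⟨ ∏≡product {n} _ ⟩
    product (λ i → f (π ⟨$⟩ʳ i))    ≈⟨ product-permute f π ⟨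
    product f                       ≡⟨ ∏≡product f ⟨
    ∏ R f                           ∎

  ∑-cong : ∀ {n} {f g : Fin n → Carrier} → (∀ i → f i ≈ g i) → ∑ R f ≈ ∑ R g
  ∑-cong {zero}  _   = refl
  ∑-cong {suc n} f≈g = +-cong (f≈g Fin.zero) (∑-cong (λ i → f≈g (Fin.suc i)))

  ∑-∑-constant : ∀ {n} (x : Carrier) {f g : Fin n → Carrier} →
                 (∀ k → f k ≈ x) → (∀ k → g k ≈ x) → ∑ R f - ∑ R g ≈ 0#
  ∑-∑-constant {n} x {f} {g} f≈x g≈x = begin
    ∑ R f - ∑ R g                          ≈⟨ +-cong (∑-cong f≈x) (-‿cong (∑-cong g≈x)) ⟩
    ∑ R {n} (λ _ → x) - ∑ R {n} (λ _ → x)  ≈⟨ -‿inverseʳ _ ⟩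
    0#                                     ∎

  rankOne-diagonal : ∀ {n} (A : Fin n → Fin n → Carrier)
                     (a w : Fin n → Carrier) → (∀ i j → A i j ≈ a i * w j) →
                     {σ : Fin n → Fin n} → IsPermutation σ →
                     ∏ R (λ i → A i (σ i)) ≈ ∏ R a * ∏ R w
  rankOne-diagonal A a w A≈aw {σ} σ-perm = begin
    ∏ R (λ i → A i (σ i))          ≈⟨ ∏-cong (λ i → A≈aw i (σ i)) ⟩
    ∏ R (λ i → a i * w (σ i))      ≈⟨ ∏-distrib-* a (λ i → w (σ i)) ⟩
    ∏ R a * ∏ R (λ i → w (σ i))    ≈⟨ *-congˡ (∏-permute w σ-perm) ⟩
    ∏ R a * ∏ R w                  ∎

ρ-isPermutation : ∀ {c ℓ} (R : CommutativeRing c ℓ) {m} (k : Fin (suc m)) →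
                  IsPermutation (ρ R k)
ρ-isPermutation R {m} k = rotation k , λ _ → ≡.refl
  where open Modular (suc m)

μ-isPermutation : ∀ {c ℓ} (R : CommutativeRing c ℓ) {m} (k : Fin (suc m)) →
                  IsPermutation (μ R k)
μ-isPermutation R {m} k = negation ∘ₚ rotation k , reflect-as-rotation (toℕ k)
  where open Modular (suc m)

theorem4 : {c ℓ : Level} (R : CommutativeRing c ℓ) (m : ℕ)
           (A : Fin (suc m) → Fin (suc m) → CommutativeRing.Carrier R) →
           RankOne R A →
           CommutativeRing._≈_ R (dih R A) (CommutativeRing.0# R)
theorem4 R m A (w , _ , rows , _) =
  ∑-∑-constant (∏ R a * ∏ R w)
    (λ k → rankOne-diagonal A a w A≈aw (ρ-isPermutation R k))
    (λ k → rankOne-diagonal A a w A≈aw (μ-isPermutation R k))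
  where
  open CommutativeRing R using (Carrier; _≈_; _*_)
  open Products R
  -- only the row-multiple part of the rank-one hypothesis is needed
  a : Fin (suc m) → Carrier
  a i = proj₁ (rows i)
  A≈aw : ∀ i j → A i j ≈ a i * w j
  A≈aw i = proj₂ (rows i)
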